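{- Let $a\ge 1$ be an integer. For integers $m\ge n\ge 0$, the number of ballot paths from $(0,0)$ to $(n,m)$ avoiding the pattern $r^{a}$ equals $$\frac{m-n+1}{m+1}\binom{m+1}{n}_{a}.$$ In particular, the number of ballot paths from $(0,0)$ to $(n,n)$ avoiding $r^{a}$ is $\dfrac{1}{n+1}\dbinom{n+1}{n}_{a}$.
   Context: A ballot path is a lattice path starting at $(0,0)$, using unit steps $u=(0,1)$ (up) and $r=(1,0)$ (right), that stays weakly above the diagonal $y=x$. A pattern is a finite word over $\{u,r\}$; $r^{a}$ denotes the word of $a$ consecutive $r$'s. A path avoids a pattern $p$ if the word of its steps contains no block of consecutive steps equal to $p$. The geometric coefficient is $\binom{x}{n}_{a}=[t^{n}](1+t+\cdots+t^{a-1})^{x}=\sum_{i=0}^{\lfloor n/a\rfloor}(-1)^{i}\binom{x}{i}\binom{x+n-ai-1}{n-ai}$. -}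

module Defs where

open import Data.Nat using (ℕ; zero; suc; _+_; _*_; _≤_)
open import Data.List using (List; []; _∷_; replicate; length; filter; map; _++_; concatMap)
open import Data.List.Relation.Unary.All using (All)
open import Data.Product using (_×_; ∃; ∃-syntax)
open import Relation.Binary.PropositionalEquality using (_≡_)
open import Relation.Nullary using (¬_)

-- Steps: u = (0,1) up, r = (1,0) right
data Step : Set where
  u r : Step

#r : List Step → ℕ
#r [] = 0
#r (r ∷ w) = suc (#r w)
#r (u ∷ w) = #r w

#u : List Step → ℕ
#u [] = 0
#u (u ∷ w) = suc (#u w)
#u (r ∷ w) = #u w

IsBallot : List Step → Set
IsBallot w = ∀ p s → p ++ s ≡ w → #r p ≤ #u p

EndsAt : ℕ → ℕ → List Step → Set
EndsAt n m w = #r w ≡ n × #u w ≡ m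

Avoids : List Step → List Step → Set
Avoids p w = ¬ (∃[ x ] ∃[ y ] x ++ p ++ y ≡ w)

words : ℕ → List (List Step)
words zero = [] ∷ []
words (suc k) = map (u ∷_) (words k) ++ map (r ∷_) (words k)

-- polynomials as coefficient lists (constant term first), natural coefficients
_⊕_ : List ℕ → List ℕ → List ℕ
[] ⊕ q = q
(x ∷ p) ⊕ [] = x ∷ p
(x ∷ p) ⊕ (y ∷ q) = (x + y) ∷ (p ⊕ q)

_⊗_ : List ℕ → List ℕ → List ℕ
[] ⊗ q = []
(x ∷ p) ⊗ q = map (x *_) q ⊕ (0 ∷ (p ⊗ q))

_^ₚ_ : List ℕ → ℕ → List ℕ
p ^ₚ zero = 1 ∷ []
p ^ₚ suc k = p ⊗ (p ^ₚ k)

coeff : List ℕ → ℕ → ℕ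
coeff [] _ = 0
coeff (x ∷ p) zero = x
coeff (x ∷ p) (suc n) = coeff p n

-- geometric coefficient  binom(x,n)_a = [t^n] (1 + t + ... + t^(a-1))^x
geomBinom : ℕ → ℕ → ℕ → ℕ
geomBinom x n a = coeff (replicate a 1 ^ₚ x) n

module Submission where

-- Write T n m for the number of ballot paths to (n, m) avoiding r^A.  Cutting
-- such a path before its last u-step (which is followed by k < A trailing r-steps) gives the
-- recurrence  T n (m+1) = Σ_{k < A, k ≤ n} T (n-k) m,  with T 0 0 = 1 and T n m = 0 for m < n.
-- The geometric coefficients G x n = [tⁿ] P(t)^x, P = 1 + t + ... + t^(A-1), satisfy the same
-- convolution recurrence in x, G (x+1) n = Σ_{k<A} G x (n-k), and the derivative identity
-- n G (x+1) n = (x+1) Σ_{k<A} k G x (n-k)  (coefficients of t (P^(x+1))' = (x+1) tP' P^x).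
-- Induction on m then gives (m+1) T n m = (m+1-n) G (m+1) n.

open import Defs
open import Data.Nat using (ℕ; zero; suc; _+_; _*_; _∸_; _≤_; _<_; z≤n; s≤s; _≤?_; _<?_; _≟_)
open import Data.Nat.Properties
open import Data.Nat.ListAction using (sum)
open import Data.Nat.ListAction.Properties using (sum-++)
open import Data.Nat.Solver using (module +-*-Solver)
open import Algebra.Properties.CommutativeSemigroup +-commutativeSemigroup using (interchange)
open import Data.Bool using (true; false; if_then_else_)
open import Data.List using (List; []; _∷_; length; filter; replicate; map; foldl; _++_; _∷ʳ_)
open import Data.List.Properties using (map-++; map-∘; foldl-∷ʳ; ∷-injective; ++-identityʳ)
open import Data.Product using (_×_; _,_; ∃-syntax)
open import Data.Empty using (⊥-elim)
open import Data.Unit using (⊤; tt)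
open import Function using (id)
open import Relation.Binary.PropositionalEquality
open import Relation.Nullary using (Dec; yes; no; ¬_; does; contradiction)
open import Relation.Unary using (Decidable)
open +-*-Solver
open ≡-Reasoning

-- Truncated convolution of a sequence f with b weights:
--   conv w b f n = Σ_{k < b, k ≤ n} w k * f (n ∸ k).
conv : (ℕ → ℕ) → ℕ → (ℕ → ℕ) → ℕ → ℕ
conv w zero    f n       = 0
conv w (suc b) f zero    = w 0 * f 0
conv w (suc b) f (suc n) = w 0 * f (suc n) + conv (λ k → w (suc k)) b f n

one : ℕ → ℕ
one _ = 1

conv-congʳ : ∀ w b {f g} → (∀ i → f i ≡ g i) → ∀ n → conv w b f n ≡ conv w b g n
conv-congʳ w zero    f≡g n       = refl
conv-congʳ w (suc b) f≡g zero    = cong (w 0 *_) (f≡g 0)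
conv-congʳ w (suc b) f≡g (suc n) = cong₂ _+_ (cong (w 0 *_) (f≡g (suc n))) (conv-congʳ _ b f≡g n)

conv-congˡ : ∀ {v w} b → (∀ k → v k ≡ w k) → ∀ f n → conv v b f n ≡ conv w b f n
conv-congˡ zero    v≡w f n       = refl
conv-congˡ (suc b) v≡w f zero    = cong (_* f 0) (v≡w 0)
conv-congˡ (suc b) v≡w f (suc n) =
  cong₂ _+_ (cong (_* f (suc n)) (v≡w 0)) (conv-congˡ b (λ k → v≡w (suc k)) f n)

conv-scaleʳ : ∀ w b c f n → conv w b (λ i → c * f i) n ≡ c * conv w b f n
conv-scaleʳ w zero    c f n       = sym (*-zeroʳ c)
conv-scaleʳ w (suc b) c f zero    = exchange (w 0) c (f 0)
  where
  exchange : ∀ x y z → x * (y * z) ≡ y * (x * z)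
  exchange = solve 3 (λ x y z → x :* (y :* z) := y :* (x :* z)) refl
conv-scaleʳ w (suc b) c f (suc n) = begin
  w 0 * (c * f (suc n)) + conv w′ b (λ i → c * f i) n ≡⟨ cong (w 0 * (c * f (suc n)) +_) (conv-scaleʳ w′ b c f n) ⟩
  w 0 * (c * f (suc n)) + c * conv w′ b f n           ≡⟨ regroup (w 0) c (f (suc n)) (conv w′ b f n) ⟩
  c * (w 0 * f (suc n) + conv w′ b f n)               ∎
  where
  w′ : ℕ → ℕ
  w′ k = w (suc k)
  regroup : ∀ x y z s → x * (y * z) + y * s ≡ y * (x * z + s)
  regroup = solve 4 (λ x y z s → x :* (y :* z) :+ y :* s := y :* (x :* z :+ s)) refl

conv-zeroʳ : ∀ w b n → conv w b (λ _ → 0) n ≡ 0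
conv-zeroʳ w b n = conv-scaleʳ w b 0 one n

conv-addʳ : ∀ w b f g n → conv w b (λ i → f i + g i) n ≡ conv w b f n + conv w b g n
conv-addʳ w zero    f g n       = refl
conv-addʳ w (suc b) f g zero    = *-distribˡ-+ (w 0) (f 0) (g 0)
conv-addʳ w (suc b) f g (suc n) = begin
  w 0 * (f (suc n) + g (suc n)) + conv w′ b (λ i → f i + g i) n
    ≡⟨ cong₂ _+_ (*-distribˡ-+ (w 0) _ _) (conv-addʳ w′ b f g n) ⟩
  (w 0 * f (suc n) + w 0 * g (suc n)) + (conv w′ b f n + conv w′ b g n)
    ≡⟨ interchange (w 0 * f (suc n)) (w 0 * g (suc n)) (conv w′ b f n) (conv w′ b g n) ⟩
  (w 0 * f (suc n) + conv w′ b f n) + (w 0 * g (suc n) + conv w′ b g n) ∎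
  where
  w′ : ℕ → ℕ
  w′ k = w (suc k)

conv-addˡ : ∀ v w b f n → conv (λ k → v k + w k) b f n ≡ conv v b f n + conv w b f n
conv-addˡ v w zero    f n       = refl
conv-addˡ v w (suc b) f zero    = *-distribʳ-+ (f 0) (v 0) (w 0)
conv-addˡ v w (suc b) f (suc n) = begin
  (v 0 + w 0) * f (suc n) + conv (λ k → v′ k + w′ k) b f n
    ≡⟨ cong₂ _+_ (*-distribʳ-+ (f (suc n)) (v 0) (w 0)) (conv-addˡ v′ w′ b f n) ⟩
  (v 0 * f (suc n) + w 0 * f (suc n)) + (conv v′ b f n + conv w′ b f n)
    ≡⟨ interchange (v 0 * f (suc n)) (w 0 * f (suc n)) (conv v′ b f n) (conv w′ b f n) ⟩
  (v 0 * f (suc n) + conv v′ b f n) + (w 0 * f (suc n) + conv w′ b f n) ∎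
  where
  v′ w′ : ℕ → ℕ
  v′ k = v (suc k)
  w′ k = w (suc k)

conv-constˡ : ∀ c b f n → conv (λ _ → c) b f n ≡ c * conv one b f n
conv-constˡ c zero    f n       = sym (*-zeroʳ c)
conv-constˡ c (suc b) f zero    = cong (c *_) (sym (*-identityˡ (f 0)))
conv-constˡ c (suc b) f (suc n) = begin
  c * f (suc n) + conv (λ _ → c) b f n     ≡⟨ cong (c * f (suc n) +_) (conv-constˡ c b f n) ⟩
  c * f (suc n) + c * conv one b f n       ≡⟨ sym (*-distribˡ-+ c _ _) ⟩
  c * (f (suc n) + conv one b f n)         ≡⟨ cong (λ q → c * (q + conv one b f n)) (sym (*-identityˡ (f (suc n)))) ⟩
  c * (1 * f (suc n) + conv one b f n)     ∎

-- Shift of a sequence by one place (multiplication by t of a generating function).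
shift : (ℕ → ℕ) → ℕ → ℕ
shift g zero    = 0
shift g (suc i) = g i

shift-cong : ∀ {f g} → (∀ i → f i ≡ g i) → ∀ n → shift f n ≡ shift g n
shift-cong f≡g zero    = refl
shift-cong f≡g (suc n) = f≡g n

conv-shift : ∀ w b g n → conv w b (shift g) n ≡ shift (conv w b g) n
conv-shift w zero    g zero          = refl
conv-shift w zero    g (suc n)       = refl
conv-shift w (suc b) g zero          = *-zeroʳ (w 0)
conv-shift w (suc b) g (suc zero)    =
  trans (cong (w 0 * g 0 +_) (conv-shift (λ k → w (suc k)) b g zero)) (+-identityʳ (w 0 * g 0))
conv-shift w (suc b) g (suc (suc n)) = cong (w 0 * g (suc n) +_) (conv-shift (λ k → w (suc k)) b g (suc n))

conv-unfold : ∀ v b f n → conv v (suc b) f n ≡ v 0 * f n + shift (conv (λ k → v (suc k)) b f) n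
conv-unfold v b f zero    = sym (+-identityʳ _)
conv-unfold v b f (suc n) = refl

-- Two truncated convolutions commute (products of generating functions commute).
conv-comm : ∀ v b w c f n → conv v b (conv w c f) n ≡ conv w c (conv v b f) n
conv-comm v zero    w c f n = sym (conv-zeroʳ w c n)
conv-comm v (suc b) w c f n = begin
  conv v (suc b) (conv w c f) n
    ≡⟨ conv-unfold v b (conv w c f) n ⟩
  v 0 * conv w c f n + shift (conv v′ b (conv w c f)) n
    ≡⟨ cong₂ _+_ (sym (conv-scaleʳ w c (v 0) f n)) shifted-tail ⟩
  conv w c (λ i → v 0 * f i) n + conv w c (shift (conv v′ b f)) n
    ≡⟨ sym (conv-addʳ w c _ _ n) ⟩
  conv w c (λ i → v 0 * f i + shift (conv v′ b f) i) n
    ≡⟨ conv-congʳ w c (λ i → sym (conv-unfold v b f i)) n ⟩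
  conv w c (conv v (suc b) f) n ∎
  where
  v′ : ℕ → ℕ
  v′ k = v (suc k)
  shifted-tail : shift (conv v′ b (conv w c f)) n ≡ conv w c (shift (conv v′ b f)) n
  shifted-tail = trans (shift-cong (conv-comm v′ b w c f) n) (sym (conv-shift w c _ n))

-- Writing the index as n = (n ∸ k) + k inside a convolution (i is an accumulated offset):
--   (i + n) Σ_k f (n∸k) = Σ_k (n∸k) f (n∸k) + Σ_k (i + k) f (n∸k).
conv-index : ∀ i b f n → (i + n) * conv one b f n ≡ conv one b (λ j → j * f j) n + conv (i +_) b f n
conv-index i zero    f n       = *-zeroʳ (i + n)
conv-index i (suc b) f zero    = cong ((i + 0) *_) (*-identityˡ (f 0))
conv-index i (suc b) f (suc n) = begin
  (i + suc n) * (1 * f (suc n) + conv one b f n)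
    ≡⟨ *-distribˡ-+ (i + suc n) _ _ ⟩
  (i + suc n) * (1 * f (suc n)) + (i + suc n) * conv one b f n
    ≡⟨ cong (λ p → (i + suc n) * (1 * f (suc n)) + p * conv one b f n) (+-suc i n) ⟩
  (i + suc n) * (1 * f (suc n)) + (suc i + n) * conv one b f n
    ≡⟨ cong ((i + suc n) * (1 * f (suc n)) +_) (conv-index (suc i) b f n) ⟩
  (i + suc n) * (1 * f (suc n)) + (conv one b (λ j → j * f j) n + conv (suc i +_) b f n)
    ≡⟨ cong (λ q → (i + suc n) * (1 * f (suc n)) + (conv one b (λ j → j * f j) n + q))
            (conv-congˡ b (λ k → sym (+-suc i k)) f n) ⟩
  (i + suc n) * (1 * f (suc n)) + (conv one b (λ j → j * f j) n + conv (λ k → i + suc k) b f n)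
    ≡⟨ rearrange i n (f (suc n)) (conv one b (λ j → j * f j) n) (conv (λ k → i + suc k) b f n) ⟩
  (1 * (suc n * f (suc n)) + conv one b (λ j → j * f j) n) + ((i + 0) * f (suc n) + conv (λ k → i + suc k) b f n) ∎
  where
  rearrange : ∀ i n x s t → (i + suc n) * (1 * x) + (s + t) ≡ (1 * (suc n * x) + s) + ((i + 0) * x + t)
  rearrange = solve 5 (λ i n x s t → (i :+ (con 1 :+ n)) :* (con 1 :* x) :+ (s :+ t)
                                   := (con 1 :* ((con 1 :+ n) :* x) :+ s) :+ ((i :+ con 0) :* x :+ t)) refl

-- For n ≤ X, the weight X ∸ (n ∸ k) on the term f (n ∸ k) equals (X ∸ n) + k.
conv-complement : ∀ X b g n → n ≤ X → conv one b (λ i → (X ∸ i) * g i) n ≡ conv ((X ∸ n) +_) b g n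
conv-complement X zero    g n       n≤X = refl
conv-complement X (suc b) g zero    n≤X = trans (*-identityˡ _) (cong (_* g 0) (sym (+-identityʳ X)))
conv-complement X (suc b) g (suc n) n≤X = cong₂ _+_
  (trans (*-identityˡ _) (cong (_* g (suc n)) (sym (+-identityʳ (X ∸ suc n)))))
  (trans (conv-complement X b g n (≤-trans (n≤1+n n) n≤X))
         (conv-congˡ b (λ k → trans (cong (_+ k) (+-∸-assoc 1 n≤X)) (sym (+-suc (X ∸ suc n) k))) g n))

coeff-⊕ : ∀ p q n → coeff (p ⊕ q) n ≡ coeff p n + coeff q n
coeff-⊕ []      q       n       = refl
coeff-⊕ (x ∷ p) []      zero    = sym (+-identityʳ x)
coeff-⊕ (x ∷ p) []      (suc n) = sym (+-identityʳ _)
coeff-⊕ (x ∷ p) (y ∷ q) zero    = refl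
coeff-⊕ (x ∷ p) (y ∷ q) (suc n) = coeff-⊕ p q n

coeff-scale : ∀ c q n → coeff (map (c *_) q) n ≡ c * coeff q n
coeff-scale c []      n       = sym (*-zeroʳ c)
coeff-scale c (x ∷ q) zero    = refl
coeff-scale c (x ∷ q) (suc n) = coeff-scale c q n

coeff-geometric-⊗ : ∀ b q n → coeff (replicate b 1 ⊗ q) n ≡ conv one b (coeff q) n
coeff-geometric-⊗ zero    q n       = refl
coeff-geometric-⊗ (suc b) q zero    = begin
  coeff (map (1 *_) q ⊕ (0 ∷ (replicate b 1 ⊗ q))) 0 ≡⟨ coeff-⊕ (map (1 *_) q) _ 0 ⟩
  coeff (map (1 *_) q) 0 + 0                          ≡⟨ +-identityʳ _ ⟩
  coeff (map (1 *_) q) 0                              ≡⟨ coeff-scale 1 q 0 ⟩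
  1 * coeff q 0                                       ∎
coeff-geometric-⊗ (suc b) q (suc n) = begin
  coeff (map (1 *_) q ⊕ (0 ∷ (replicate b 1 ⊗ q))) (suc n)  ≡⟨ coeff-⊕ (map (1 *_) q) _ (suc n) ⟩
  coeff (map (1 *_) q) (suc n) + coeff (replicate b 1 ⊗ q) n ≡⟨ cong₂ _+_ (coeff-scale 1 q (suc n)) (coeff-geometric-⊗ b q n) ⟩
  1 * coeff q (suc n) + conv one b (coeff q) n               ∎

geomBinom-suc : ∀ a x n → geomBinom (suc x) n a ≡ conv one a (λ i → geomBinom x i a) n
geomBinom-suc a x n = coeff-geometric-⊗ a (replicate a 1 ^ₚ x) n

-- Derivative identity: the coefficients of t (P^(x+1))′ = (x+1) · tP′ · P^x, where tP′ has
-- coefficients k for k < a:   n G (x+1) n = (x+1) Σ_{k<a} k G x (n-k).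
geomBinom-deriv : ∀ a x n → n * geomBinom (suc x) n a ≡ suc x * conv id a (λ i → geomBinom x i a) n
geomBinom-deriv a zero n = begin
  n * G 1 n                                         ≡⟨ cong (n *_) (geomBinom-suc a 0 n) ⟩
  (0 + n) * conv one a (G 0) n                      ≡⟨ conv-index 0 a (G 0) n ⟩
  conv one a (λ j → j * G 0 j) n + conv id a (G 0) n
    ≡⟨ cong (_+ conv id a (G 0) n) (trans (conv-congʳ one a j*G0j≡0 n) (conv-zeroʳ one a n)) ⟩
  conv id a (G 0) n                                 ≡⟨ sym (+-identityʳ _) ⟩
  1 * conv id a (G 0) n                             ∎
  where
  G : ℕ → ℕ → ℕ
  G x i = geomBinom x i a
  -- G 0 is the sequence 1, 0, 0, ...
  j*G0j≡0 : ∀ j → j * G 0 j ≡ 0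
  j*G0j≡0 zero    = refl
  j*G0j≡0 (suc j) = *-zeroʳ (suc j)
geomBinom-deriv a (suc x) n = begin
  n * G (suc (suc x)) n
    ≡⟨ cong (n *_) (geomBinom-suc a (suc x) n) ⟩
  (0 + n) * conv one a (G (suc x)) n
    ≡⟨ conv-index 0 a (G (suc x)) n ⟩
  conv one a (λ j → j * G (suc x) j) n + S
    ≡⟨ cong (_+ S) (conv-congʳ one a (geomBinom-deriv a x) n) ⟩
  conv one a (λ j → suc x * conv id a (G x) j) n + S
    ≡⟨ cong (_+ S) (conv-scaleʳ one a (suc x) _ n) ⟩
  suc x * conv one a (conv id a (G x)) n + S
    ≡⟨ cong (λ q → suc x * q + S) (conv-comm one a id a (G x) n) ⟩
  suc x * conv id a (conv one a (G x)) n + S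
    ≡⟨ cong (λ q → suc x * q + S) (conv-congʳ id a (λ i → sym (geomBinom-suc a x i)) n) ⟩
  suc x * S + S
    ≡⟨ +-comm (suc x * S) S ⟩
  suc (suc x) * S ∎
  where
  G : ℕ → ℕ → ℕ
  G x i = geomBinom x i a
  S : ℕ
  S = conv id a (G (suc x)) n

formula-arithmetic : ∀ X n d T S₁ S₂ → n + d ≡ X → X * T ≡ d * S₁ + S₂ → n * S₁ ≡ suc X * S₂ →
                     X * (suc X * T) ≡ X * (suc d * S₁)
formula-arithmetic .(n + d) n d T S₁ S₂ refl XT≡ nS₁≡ = begin
  (n + d) * (suc (n + d) * T)          ≡⟨ swap n d T ⟩
  suc (n + d) * ((n + d) * T)          ≡⟨ cong (suc (n + d) *_) XT≡ ⟩
  suc (n + d) * (d * S₁ + S₂)          ≡⟨ *-distribˡ-+ (suc (n + d)) (d * S₁) S₂ ⟩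
  suc (n + d) * (d * S₁) + suc (n + d) * S₂ ≡⟨ cong (suc (n + d) * (d * S₁) +_) (sym nS₁≡) ⟩
  suc (n + d) * (d * S₁) + n * S₁      ≡⟨ collect n d S₁ ⟩
  (n + d) * (suc d * S₁)               ∎
  where
  swap : ∀ n d T → (n + d) * (suc (n + d) * T) ≡ suc (n + d) * ((n + d) * T)
  swap = solve 3 (λ n d T → (n :+ d) :* ((con 1 :+ (n :+ d)) :* T) := (con 1 :+ (n :+ d)) :* ((n :+ d) :* T)) refl
  collect : ∀ n d S → suc (n + d) * (d * S) + n * S ≡ (n + d) * (suc d * S)
  collect = solve 3 (λ n d S → (con 1 :+ (n :+ d)) :* (d :* S) :+ n :* S := (n :+ d) :* ((con 1 :+ d) :* S)) refl

module BallotRecurrence (a : ℕ) (T : ℕ → ℕ → ℕ)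
  (T-origin : T 0 0 ≡ 1)
  (T-below-diagonal : ∀ n m → m < n → T n m ≡ 0)
  (T-step : ∀ n m → n ≤ suc m → T n (suc m) ≡ conv one (suc a) (λ i → T i m) n)
  where

  G : ℕ → ℕ → ℕ
  G x n = geomBinom x n (suc a)

  formula-step : ∀ m n → n ≤ suc m →
    (∀ i → suc m * T i m ≡ (suc m ∸ i) * G (suc m) i) →
    suc (suc m) * T n (suc m) ≡ (suc (suc m) ∸ n) * G (suc (suc m)) n
  formula-step m n n≤X ih = *-cancelˡ-≡ _ _ X X[X+1]T≡X[d+1]S₁
    where
    X d S₁ S₂ : ℕ
    X  = suc m
    d  = X ∸ n
    S₁ = conv one (suc a) (G X) n
    S₂ = conv id (suc a) (G X) n
    XT≡dS₁+S₂ : X * T n X ≡ d * S₁ + S₂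
    XT≡dS₁+S₂ = begin
      X * T n X                                   ≡⟨ cong (X *_) (T-step n m n≤X) ⟩
      X * conv one (suc a) (λ i → T i m) n        ≡⟨ sym (conv-scaleʳ one (suc a) X _ n) ⟩
      conv one (suc a) (λ i → X * T i m) n        ≡⟨ conv-congʳ one (suc a) ih n ⟩
      conv one (suc a) (λ i → (X ∸ i) * G X i) n  ≡⟨ conv-complement X (suc a) (G X) n n≤X ⟩
      conv (λ k → d + k) (suc a) (G X) n          ≡⟨ conv-addˡ (λ _ → d) id (suc a) (G X) n ⟩
      conv (λ _ → d) (suc a) (G X) n + S₂         ≡⟨ cong (_+ S₂) (conv-constˡ d (suc a) (G X) n) ⟩
      d * S₁ + S₂                                 ∎
    nS₁≡[X+1]S₂ : n * S₁ ≡ suc X * S₂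
    nS₁≡[X+1]S₂ = trans (cong (n *_) (sym (geomBinom-suc (suc a) X n))) (geomBinom-deriv (suc a) X n)
    X[X+1]T≡X[d+1]S₁ : X * (suc X * T n X) ≡ X * ((suc X ∸ n) * G (suc X) n)
    X[X+1]T≡X[d+1]S₁ = begin
      X * (suc X * T n X)  ≡⟨ formula-arithmetic X n d (T n X) S₁ S₂ (m+[n∸m]≡n n≤X) XT≡dS₁+S₂ nS₁≡[X+1]S₂ ⟩
      X * (suc d * S₁)     ≡⟨ cong (X *_) (cong₂ _*_ (sym (+-∸-assoc 1 n≤X)) (sym (geomBinom-suc (suc a) X n))) ⟩
      X * ((suc X ∸ n) * G (suc X) n) ∎

  ballot-formula : ∀ m n → suc m * T n m ≡ (suc m ∸ n) * G (suc m) n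
  ballot-formula zero    zero    = cong (1 *_) T-origin
  ballot-formula zero    (suc n) rewrite T-below-diagonal (suc n) 0 (s≤s z≤n) | 0∸n≡0 n = refl
  ballot-formula (suc m) n with n ≤? suc m
  ... | yes n≤X = formula-step m n n≤X (ballot-formula m)
  ... | no  n≰X rewrite T-below-diagonal n (suc m) (≰⇒> n≰X) | m≤n⇒m∸n≡0 (≰⇒> n≰X)
                      | *-zeroʳ (suc (suc m)) = refl

-- count k χ = Σ_{w ∈ {u,r}^k} χ w, organised by the first step of w.
count : ℕ → (List Step → ℕ) → ℕ
count zero    χ = χ []
count (suc k) χ = count k (λ w → χ (u ∷ w)) + count k (λ w → χ (r ∷ w))

count-words : ∀ k χ → sum (map χ (words k)) ≡ count k χ
count-words zero    χ = +-identityʳ (χ [])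
count-words (suc k) χ = begin
  sum (map χ (map (u ∷_) ws ++ map (r ∷_) ws))
    ≡⟨ cong sum (map-++ χ (map (u ∷_) ws) _) ⟩
  sum (map χ (map (u ∷_) ws) ++ map χ (map (r ∷_) ws))
    ≡⟨ sum-++ (map χ (map (u ∷_) ws)) _ ⟩
  sum (map χ (map (u ∷_) ws)) + sum (map χ (map (r ∷_) ws))
    ≡⟨ cong₂ _+_ (cong sum (sym (map-∘ ws))) (cong sum (sym (map-∘ ws))) ⟩
  sum (map (λ w → χ (u ∷ w)) ws) + sum (map (λ w → χ (r ∷ w)) ws)
    ≡⟨ cong₂ _+_ (count-words k _) (count-words k _) ⟩
  count (suc k) χ ∎
  where
  ws : List (List Step)
  ws = words k

count-cong : ∀ k {χ ψ} → (∀ w → χ w ≡ ψ w) → count k χ ≡ count k ψ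
count-cong zero    χ≡ψ = χ≡ψ []
count-cong (suc k) χ≡ψ = cong₂ _+_ (count-cong k (λ w → χ≡ψ (u ∷ w))) (count-cong k (λ w → χ≡ψ (r ∷ w)))

count-add : ∀ k χ ψ → count k (λ w → χ w + ψ w) ≡ count k χ + count k ψ
count-add zero    χ ψ = refl
count-add (suc k) χ ψ =
  trans (cong₂ _+_ (count-add k χᵤ ψᵤ) (count-add k χᵣ ψᵣ))
        (interchange (count k χᵤ) (count k ψᵤ) (count k χᵣ) (count k ψᵣ))
  where
  χᵤ χᵣ ψᵤ ψᵣ : List Step → ℕ
  χᵤ w = χ (u ∷ w)
  χᵣ w = χ (r ∷ w)
  ψᵤ w = ψ (u ∷ w)
  ψᵣ w = ψ (r ∷ w)

count-null : ∀ k {χ} → (∀ w → χ w ≡ 0) → count k χ ≡ 0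
count-null zero    χ≡0 = χ≡0 []
count-null (suc k) χ≡0 = cong₂ _+_ (count-null k (λ w → χ≡0 (u ∷ w))) (count-null k (λ w → χ≡0 (r ∷ w)))

count-snoc : ∀ k χ → count (suc k) χ ≡ count k (λ w → χ (w ∷ʳ u)) + count k (λ w → χ (w ∷ʳ r))
count-snoc zero    χ = refl
count-snoc (suc k) χ =
  trans (cong₂ _+_ (count-snoc k (λ w → χ (u ∷ w))) (count-snoc k (λ w → χ (r ∷ w))))
        (interchange (count k (ends u u)) (count k (ends u r)) (count k (ends r u)) (count k (ends r r)))
  where
  ends : Step → Step → List Step → ℕ
  ends c c′ w = χ (c ∷ (w ∷ʳ c′))

length-filter : ∀ {P : List Step → Set} (P? : Decidable P) ws →
  length (filter P? ws) ≡ sum (map (λ w → if does (P? w) then 1 else 0) ws)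
length-filter P? []       = refl
length-filter P? (w ∷ ws) with does (P? w)
... | true  = cong suc (length-filter P? ws)
... | false = length-filter P? ws

Prefix : List Step → List Step → Set
Prefix p v = ∃[ s ] p ++ s ≡ v

avoids-tail : ∀ p c w → Avoids p (c ∷ w) → Avoids p w
avoids-tail p c w avoids (x , y , eq) = avoids ((c ∷ x) , y , cong (c ∷_) eq)

avoids-head : ∀ p c w → Avoids p (c ∷ w) → ¬ Prefix p (c ∷ w)
avoids-head p c w avoids (y , eq) = avoids ([] , y , eq)

avoids-cons : ∀ p c w → ¬ Prefix p (c ∷ w) → Avoids p w → Avoids p (c ∷ w)
avoids-cons p c w not-prefix avoids ([]      , y , eq) = not-prefix (y , eq)
avoids-cons p c w not-prefix avoids ((_ ∷ x) , y , eq) with ∷-injective eq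
... | refl , eq′ = avoids (x , y , eq′)

avoids-[] : ∀ c p → Avoids (c ∷ p) []
avoids-[] c p ([]      , y , ())
avoids-[] c p ((_ ∷ _) , y , ())

leadingRs : List Step → ℕ
leadingRs []      = 0
leadingRs (u ∷ w) = 0
leadingRs (r ∷ w) = suc (leadingRs w)

prefix⇒leadingRs : ∀ k v → Prefix (replicate k r) v → k ≤ leadingRs v
prefix⇒leadingRs zero    v       _        = z≤n
prefix⇒leadingRs (suc k) []      (s , ())
prefix⇒leadingRs (suc k) (c ∷ v) (s , eq) with ∷-injective eq
... | refl , eq′ = s≤s (prefix⇒leadingRs k v (s , eq′))

leadingRs⇒prefix : ∀ k v → k ≤ leadingRs v → Prefix (replicate k r) v
leadingRs⇒prefix zero    v       _         = v , refl
leadingRs⇒prefix (suc k) (r ∷ v) (s≤s k≤l) with leadingRs⇒prefix k v k≤l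
... | s , eq = s , cong (r ∷_) eq

BallotFrom : ℕ → ℕ → List Step → Set
BallotFrom x y w = ∀ p s → p ++ s ≡ w → x + #r p ≤ y + #u p

ballotFrom-[] : ∀ {x y} → x ≤ y → BallotFrom x y []
ballotFrom-[] {x} {y} x≤y [] [] refl rewrite +-identityʳ x | +-identityʳ y = x≤y

ballotFrom-u← : ∀ {x y w} → x ≤ y → BallotFrom x (suc y) w → BallotFrom x y (u ∷ w)
ballotFrom-u← {x} {y} x≤y ballot []      s eq rewrite +-identityʳ x | +-identityʳ y = x≤y
ballotFrom-u← {x} {y} x≤y ballot (c ∷ p) s eq with ∷-injective eq
... | refl , eq′ rewrite +-suc y (#u p) = ballot p s eq′

ballotFrom-r← : ∀ {x y w} → x ≤ y → BallotFrom (suc x) y w → BallotFrom x y (r ∷ w)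
ballotFrom-r← {x} {y} x≤y ballot []      s eq rewrite +-identityʳ x | +-identityʳ y = x≤y
ballotFrom-r← {x} {y} x≤y ballot (c ∷ p) s eq with ∷-injective eq
... | refl , eq′ rewrite +-suc x (#r p) = ballot p s eq′

ballotFrom-u→ : ∀ {x y w} → BallotFrom x y (u ∷ w) → BallotFrom x (suc y) w
ballotFrom-u→ {x} {y} ballot p s eq with ballot (u ∷ p) s (cong (u ∷_) eq)
... | x≤y rewrite +-suc y (#u p) = x≤y

ballotFrom-r→ : ∀ {x y w} → BallotFrom x y (r ∷ w) → BallotFrom (suc x) y w
ballotFrom-r→ {x} {y} ballot p s eq with ballot (r ∷ p) s (cong (r ∷_) eq)
... | x≤y rewrite +-suc x (#r p) = x≤y

ballotFrom-r-head : ∀ {x y w} → BallotFrom x y (r ∷ w) → suc x ≤ y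
ballotFrom-r-head {x} {y} {w} ballot with ballot (r ∷ []) w refl
... | x+1≤y+0 rewrite +-comm x 1 | +-identityʳ y = x+1≤y+0

ballot-end : ∀ w → IsBallot w → #r w ≤ #u w
ballot-end w ballot = ballot w [] (++-identityʳ w)

-- An automaton reading a word left to right that stays alive exactly on the ballot words
-- avoiding r^A, where A = a + 1 ≥ 1.
module Automaton (a : ℕ) where

  A : ℕ
  A = suc a

  -- A live state st x y z records the endpoint (x, y) = (#r, #u) of the word read so far and
  -- the length z of its final run of r-steps; dead is absorbing.
  data State : Set where
    dead : State
    st   : ℕ → ℕ → ℕ → State

  guard : ∀ {P : Set} → Dec P → State → State
  guard (yes _) s = s
  guard (no _)  _ = dead

  step : State → Step → State
  step dead       _ = dead
  step (st x y z) u = guard (z <? A) (st x (suc y) 0)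
  step (st x y z) r = guard (suc x ≤? y) (guard (suc z <? A) (st (suc x) y (suc z)))

  run : List Step → State
  run = foldl step (st 0 0 0)

  foldl-dead : ∀ w → foldl step dead w ≡ dead
  foldl-dead []      = refl
  foldl-dead (c ∷ w) = foldl-dead w

  ShortRuns : List Step → Set
  ShortRuns []      = ⊤
  ShortRuns (c ∷ w) = leadingRs (c ∷ w) < A × ShortRuns w

  shortRuns-head : ∀ w → ShortRuns w → leadingRs w < A
  shortRuns-head []      _         = s≤s z≤n
  shortRuns-head (c ∷ w) (l<A , _) = l<A

  avoids⇒shortRuns : ∀ w → Avoids (replicate A r) w → ShortRuns w
  avoids⇒shortRuns []      _      = tt
  avoids⇒shortRuns (c ∷ w) avoids =
    ≰⇒> (λ A≤l → avoids-head _ c w avoids (leadingRs⇒prefix A (c ∷ w) A≤l)) ,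
    avoids⇒shortRuns w (avoids-tail _ c w avoids)

  shortRuns⇒avoids : ∀ w → ShortRuns w → Avoids (replicate A r) w
  shortRuns⇒avoids []      _           = avoids-[] r (replicate a r)
  shortRuns⇒avoids (c ∷ w) (l<A , short) =
    avoids-cons _ c w (λ prefix → <⇒≱ l<A (prefix⇒leadingRs A (c ∷ w) prefix)) (shortRuns⇒avoids w short)

  run-sound : ∀ w x y z x′ y′ z′ → x ≤ y → z < A → foldl step (st x y z) w ≡ st x′ y′ z′ →
    BallotFrom x y w × ShortRuns w × z + leadingRs w < A × x′ ≡ x + #r w × y′ ≡ y + #u w
  run-sound [] x y z .x .y .z x≤y z<A refl =
    ballotFrom-[] x≤y , tt , subst (_< A) (sym (+-identityʳ z)) z<A , sym (+-identityʳ x) , sym (+-identityʳ y)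
  run-sound (u ∷ w) x y z x′ y′ z′ x≤y z<A eq with z <? A
  ... | no z≮A = contradiction z<A z≮A
  ... | yes _ with run-sound w x (suc y) 0 x′ y′ z′ (m≤n⇒m≤1+n x≤y) (s≤s z≤n) eq
  ...   | ballot , short , _ , x′≡ , y′≡ =
    ballotFrom-u← x≤y ballot , (s≤s z≤n , short) , subst (_< A) (sym (+-identityʳ z)) z<A ,
    x′≡ , trans y′≡ (sym (+-suc y (#u w)))
  run-sound (r ∷ w) x y z x′ y′ z′ x≤y z<A eq with suc x ≤? y | suc z <? A
  ... | no _  | _     = contradiction (trans (sym (foldl-dead w)) eq) λ ()
  ... | yes _ | no _  = contradiction (trans (sym (foldl-dead w)) eq) λ ()
  ... | yes x<y | yes z+1<A with run-sound w (suc x) y (suc z) x′ y′ z′ x<y z+1<A eq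
  ...   | ballot , short , bound , x′≡ , y′≡ =
    ballotFrom-r← x≤y ballot ,
    (≤-trans (s≤s (s≤s (m≤n+m (leadingRs w) z))) bound , short) ,
    subst (_< A) (sym (+-suc z (leadingRs w))) bound ,
    trans x′≡ (sym (+-suc x (#r w))) , y′≡

  run-complete : ∀ w x y z → BallotFrom x y w → ShortRuns w → z + leadingRs w < A →
    ∃[ z′ ] z′ < A × foldl step (st x y z) w ≡ st (x + #r w) (y + #u w) z′
  run-complete [] x y z _ _ bound rewrite +-identityʳ x | +-identityʳ y =
    z , subst (_< A) (+-identityʳ z) bound , refl
  run-complete (u ∷ w) x y z ballot (_ , short) bound with z <? A
  ... | no z≮A = contradiction (m+n≤o⇒m≤o (suc z) bound) z≮A
  ... | yes _ with run-complete w x (suc y) 0 (ballotFrom-u→ ballot) short (shortRuns-head w short)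
  ...   | z′ , z′<A , eq rewrite +-suc y (#u w) = z′ , z′<A , eq
  run-complete (r ∷ w) x y z ballot (_ , short) bound with suc x ≤? y | suc z <? A
  ... | no x≮y | _ = contradiction (ballotFrom-r-head ballot) x≮y
  ... | yes _  | no z+1≮A = contradiction (m+n≤o⇒m≤o (suc (suc z)) bound′) z+1≮A
    where
    bound′ : suc z + leadingRs w < A
    bound′ = subst (_< A) (+-suc z (leadingRs w)) bound
  ... | yes _  | yes _ with run-complete w (suc x) y (suc z) (ballotFrom-r→ ballot) short
                                         (subst (_< A) (+-suc z (leadingRs w)) bound)
  ...   | z′ , z′<A , eq rewrite +-suc x (#r w) = z′ , z′<A , eq

  δ : ℕ → ℕ → ℕ
  δ zero    zero    = 1
  δ zero    (suc _) = 0
  δ (suc _) zero    = 0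
  δ (suc x) (suc y) = δ x y

  δ-refl : ∀ x → δ x x ≡ 1
  δ-refl zero    = refl
  δ-refl (suc x) = δ-refl x

  δ-≢ : ∀ x y → x ≢ y → δ x y ≡ 0
  δ-≢ zero    zero    x≢y = contradiction refl x≢y
  δ-≢ zero    (suc y) x≢y = refl
  δ-≢ (suc x) zero    x≢y = refl
  δ-≢ (suc x) (suc y) x≢y = δ-≢ x y (λ x≡y → x≢y (cong suc x≡y))

  below : ℕ → ℕ → ℕ
  below zero    z       = 0
  below (suc c) zero    = 1
  below (suc c) (suc z) = below c z

  below-< : ∀ {c z} → z < c → below c z ≡ 1
  below-< {suc c} {zero}  _         = refl
  below-< {suc c} {suc z} (s≤s z<c) = below-< z<c

  below-≥ : ∀ {c z} → c ≤ z → below c z ≡ 0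
  below-≥ {zero}  _         = refl
  below-≥ {suc c} (s≤s c≤z) = below-≥ c≤z

  -- A run shorter than c + 1 is either empty or a run shorter than c extended by one r-step.
  below-suc : ∀ c z → below (suc c) z ≡ δ 0 z + shift (below c) z
  below-suc c zero    = refl
  below-suc c (suc z) = refl

  -- at n m ρ s: the state s is live at the point (n, m), weighted by ρ of its final run.
  at : ℕ → ℕ → (ℕ → ℕ) → State → ℕ
  at n m ρ dead       = 0
  at n m ρ (st x y z) = δ x n * δ y m * ρ z

  at-vanish : ∀ n m ρ x y z → (x ≡ n → y ≡ m → ρ z ≡ 0) → at n m ρ (st x y z) ≡ 0
  at-vanish n m ρ x y z h with x ≟ n | y ≟ m
  ... | no x≢n   | _        rewrite δ-≢ x n x≢n = refl
  ... | yes _    | no y≢m   rewrite δ-≢ y m y≢m | *-zeroʳ (δ x n) = refl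
  ... | yes x≡n  | yes y≡m  = trans (cong (δ x n * δ y m *_) (h x≡n y≡m)) (*-zeroʳ (δ x n * δ y m))

  at-null : ∀ n m {ρ} → (∀ z → ρ z ≡ 0) → ∀ s → at n m ρ s ≡ 0
  at-null n m ρ≡0 dead       = refl
  at-null n m {ρ} ρ≡0 (st x y z) = at-vanish n m ρ x y z (λ _ _ → ρ≡0 z)

  at-split : ∀ n m {ρ} σ τ → (∀ z → ρ z ≡ σ z + τ z) → ∀ s → at n m ρ s ≡ at n m σ s + at n m τ s
  at-split n m σ τ split dead       = refl
  at-split n m σ τ split (st x y z) =
    trans (cong (δ x n * δ y m *_) (split z)) (*-distribˡ-+ (δ x n * δ y m) (σ z) (τ z))

  at-after-u : ∀ n m ρ s → at n (suc m) ρ (step s u) ≡ ρ 0 * at n m (below A) s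
  at-after-u n m ρ dead = sym (*-zeroʳ (ρ 0))
  at-after-u n m ρ (st x y z) with z <? A
  ... | yes z<A rewrite below-< z<A = trans (*-comm (δ x n * δ y m) (ρ 0)) (cong (ρ 0 *_) (sym (*-identityʳ _)))
  ... | no z≮A rewrite below-≥ (≮⇒≥ z≮A) | *-zeroʳ (δ x n * δ y m) = sym (*-zeroʳ (ρ 0))

  at-after-r-column0 : ∀ m ρ s → at 0 m ρ (step s r) ≡ 0
  at-after-r-column0 m ρ dead = refl
  at-after-r-column0 m ρ (st x y z) with suc x ≤? y | suc z <? A
  ... | yes _ | yes _ = refl
  ... | yes _ | no _  = refl
  ... | no _  | _     = refl

  at-after-r-run0 : ∀ n m ρ → (∀ z → ρ (suc z) ≡ 0) → ∀ s → at n m ρ (step s r) ≡ 0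
  at-after-r-run0 n m ρ ρ₊≡0 dead = refl
  at-after-r-run0 n m ρ ρ₊≡0 (st x y z) with suc x ≤? y | suc z <? A
  ... | yes _ | yes _ rewrite ρ₊≡0 z = *-zeroʳ (δ (suc x) n * δ y m)
  ... | yes _ | no _  = refl
  ... | no _  | _     = refl

  at-after-r : ∀ n m ρ → suc n ≤ m → (∀ z → A ≤ suc z → ρ z ≡ 0) →
               ∀ s → at (suc n) m (shift ρ) (step s r) ≡ at n m ρ s
  at-after-r n m ρ n<m long⇒0 dead = refl
  at-after-r n m ρ n<m long⇒0 (st x y z) with suc x ≤? y | suc z <? A
  ... | yes _ | yes _    = refl
  ... | yes _ | no z+1≮A = sym (at-vanish n m ρ x y z (λ _ _ → long⇒0 z (≮⇒≥ z+1≮A)))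
  ... | no x≮y | _       = sym (at-vanish n m ρ x y z (λ { refl refl → contradiction n<m x≮y }))

  at-here : ∀ {n m x y z} → x ≡ n → y ≡ m → z < A → at n m (below A) (st x y z) ≡ 1
  at-here {x = x} {y} refl refl z<A rewrite δ-refl x | δ-refl y | below-< z<A = refl

  countRuns : ℕ → (State → ℕ) → ℕ
  countRuns k φ = count k (λ w → φ (run w))

  countRuns-cong : ∀ k {φ ψ} → (∀ s → φ s ≡ ψ s) → countRuns k φ ≡ countRuns k ψ
  countRuns-cong k φ≡ψ = count-cong k (λ w → φ≡ψ (run w))

  countRuns-null : ∀ k {φ} → (∀ s → φ s ≡ 0) → countRuns k φ ≡ 0
  countRuns-null k φ≡0 = count-null k (λ w → φ≡0 (run w))

  countRuns-split : ∀ k n m {ρ} σ τ → (∀ z → ρ z ≡ σ z + τ z) →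
    countRuns k (at n m ρ) ≡ countRuns k (at n m σ) + countRuns k (at n m τ)
  countRuns-split k n m σ τ split = trans (countRuns-cong k (at-split n m σ τ split))
    (count-add k (λ w → at n m σ (run w)) (λ w → at n m τ (run w)))

  countRuns-snoc : ∀ k φ → countRuns (suc k) φ ≡ countRuns k (λ s → φ (step s u)) + countRuns k (λ s → φ (step s r))
  countRuns-snoc k φ = trans (count-snoc k (λ w → φ (run w)))
    (cong₂ _+_ (count-cong k (λ w → cong φ (foldl-∷ʳ step (st 0 0 0) u w)))
               (count-cong k (λ w → cong φ (foldl-∷ʳ step (st 0 0 0) r w))))

  -- A path at (0, m) has no r-steps, hence an empty final run.
  countRuns-column0 : ∀ m ρ → countRuns m (at 0 m (shift ρ)) ≡ 0
  countRuns-column0 zero    ρ = refl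
  countRuns-column0 (suc m) ρ = trans (countRuns-snoc m (at 0 (suc m) (shift ρ)))
    (cong₂ _+_ (countRuns-null m (at-after-u 0 m (shift ρ))) (countRuns-null m (at-after-r-column0 (suc m) (shift ρ))))

  -- Strictly above the diagonal, the paths at (n+1, m) whose final run is nonempty and shorter
  -- than c + 1 are the paths at (n, m) with final run shorter than c, followed by an r-step.
  countRuns-last-r : ∀ c n m → c ≤ a → suc n ≤ m →
    countRuns (suc n + m) (at (suc n) m (shift (below c))) ≡ countRuns (n + m) (at n m (below c))
  countRuns-last-r c n (suc m) c≤a n<m = trans (countRuns-snoc (n + suc m) (at (suc n) (suc m) (shift (below c))))
    (cong₂ _+_ (countRuns-null (n + suc m) (at-after-u (suc n) m (shift (below c))))
               (countRuns-cong (n + suc m) (at-after-r n (suc m) (below c) n<m long⇒0)))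
    where
    long⇒0 : ∀ z → A ≤ suc z → below c z ≡ 0
    long⇒0 z (s≤s a≤z) = below-≥ (≤-trans c≤a a≤z)

  EndingInU : ℕ → ℕ → ℕ
  EndingInU i m = countRuns (i + m) (at i m (δ 0))

  -- Peeling off the final run: for c ≤ A and n ≤ m, a path at (n, m) with final run shorter
  -- than c is a path at (n ∸ k, m) with empty final run followed by r^k, for some k < c.
  countRuns-final-run : ∀ c n m → c ≤ A → n ≤ m →
    countRuns (n + m) (at n m (below c)) ≡ conv one c (λ i → EndingInU i m) n
  countRuns-final-run zero    n       m _         _   = countRuns-null (n + m) (at-null n m (λ _ → refl))
  countRuns-final-run (suc c) zero    m _         _   = begin
    countRuns m (at 0 m (below (suc c)))
      ≡⟨ countRuns-split m 0 m (δ 0) (shift (below c)) (below-suc c) ⟩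
    EndingInU 0 m + countRuns m (at 0 m (shift (below c)))
      ≡⟨ cong (EndingInU 0 m +_) (countRuns-column0 m (below c)) ⟩
    EndingInU 0 m + 0
      ≡⟨ trans (+-identityʳ _) (sym (*-identityˡ _)) ⟩
    1 * EndingInU 0 m ∎
  countRuns-final-run (suc c) (suc n) m (s≤s c≤a) n<m = begin
    countRuns (suc n + m) (at (suc n) m (below (suc c)))
      ≡⟨ countRuns-split (suc n + m) (suc n) m (δ 0) (shift (below c)) (below-suc c) ⟩
    EndingInU (suc n) m + countRuns (suc n + m) (at (suc n) m (shift (below c)))
      ≡⟨ cong₂ _+_ (sym (*-identityˡ _)) (countRuns-last-r c n m c≤a n<m) ⟩
    1 * EndingInU (suc n) m + countRuns (n + m) (at n m (below c))
      ≡⟨ cong (1 * EndingInU (suc n) m +_) (countRuns-final-run c n m (m≤n⇒m≤1+n c≤a) (≤-trans (n≤1+n n) n<m)) ⟩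
    1 * EndingInU (suc n) m + conv one c (λ i → EndingInU i m) n ∎

  -- The number of ballot paths to (n, m) avoiding r^A (see filter-count).
  pathCount : ℕ → ℕ → ℕ
  pathCount n m = countRuns (n + m) (at n m (below A))

  endingInU-suc : ∀ i m → EndingInU i (suc m) ≡ pathCount i m
  endingInU-suc i m = begin
    countRuns (i + suc m) (at i (suc m) (δ 0))
      ≡⟨ cong (λ k → countRuns k (at i (suc m) (δ 0))) (+-suc i m) ⟩
    countRuns (suc (i + m)) (at i (suc m) (δ 0))
      ≡⟨ countRuns-snoc (i + m) (at i (suc m) (δ 0)) ⟩
    countRuns (i + m) (λ s → at i (suc m) (δ 0) (step s u)) + countRuns (i + m) (λ s → at i (suc m) (δ 0) (step s r))
      ≡⟨ cong₂ _+_ (countRuns-cong (i + m) (λ s → trans (at-after-u i m (δ 0) s) (*-identityˡ _)))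
                   (countRuns-null (i + m) (at-after-r-run0 i (suc m) (δ 0) (λ _ → refl))) ⟩
    pathCount i m + 0
      ≡⟨ +-identityʳ _ ⟩
    pathCount i m ∎

  pathCount-step : ∀ n m → n ≤ suc m → pathCount n (suc m) ≡ conv one A (λ i → pathCount i m) n
  pathCount-step n m n≤m+1 =
    trans (countRuns-final-run A n (suc m) ≤-refl n≤m+1) (conv-congʳ one A (λ i → endingInU-suc i m) n)

  -- Every live final state lies weakly above the diagonal.
  pathCount-below-diagonal : ∀ n m → m < n → pathCount n m ≡ 0
  pathCount-below-diagonal n m m<n = count-null (n + m) vanish
    where
    vanish : ∀ w → at n m (below A) (run w) ≡ 0
    vanish w with run w in eq
    ... | dead = refl
    ... | st x y z with run-sound w 0 0 0 x y z z≤n (s≤s z≤n) eq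
    ...   | ballot , _ , _ , x≡#r , y≡#u = at-vanish n m (below A) x y z λ { refl refl →
            contradiction (subst₂ _≤_ (sym x≡#r) (sym y≡#u) (ballot-end w ballot)) (<⇒≱ m<n) }

  indicator-run : ∀ n m (P? : Decidable (λ w → IsBallot w × EndsAt n m w × Avoids (replicate A r) w)) w →
    (if does (P? w) then 1 else 0) ≡ at n m (below A) (run w)
  indicator-run n m P? w with P? w
  ... | yes (ballot , (#r≡n , #u≡m) , avoids)
      with run-complete w 0 0 0 ballot (avoids⇒shortRuns w avoids) (shortRuns-head w (avoids⇒shortRuns w avoids))
  ...   | z′ , z′<A , eq = sym (trans (cong (at n m (below A)) eq) (at-here #r≡n #u≡m z′<A))
  indicator-run n m P? w | no not-counted with run w in eq
  ... | dead = refl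
  ... | st x y z with run-sound w 0 0 0 x y z z≤n (s≤s z≤n) eq
  ...   | ballot , short , _ , x≡#r , y≡#u = sym (at-vanish n m (below A) x y z λ { refl refl →
          ⊥-elim (not-counted (ballot , (sym x≡#r , sym y≡#u) , shortRuns⇒avoids w short)) })

  filter-count : ∀ n m (P? : Decidable (λ w → IsBallot w × EndsAt n m w × Avoids (replicate A r) w)) →
    length (filter P? (words (n + m))) ≡ pathCount n m
  filter-count n m P? = begin
    length (filter P? (words (n + m)))                               ≡⟨ length-filter P? (words (n + m)) ⟩
    sum (map (λ w → if does (P? w) then 1 else 0) (words (n + m)))   ≡⟨ count-words (n + m) _ ⟩
    count (n + m) (λ w → if does (P? w) then 1 else 0)               ≡⟨ count-cong (n + m) (indicator-run n m P?) ⟩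
    pathCount n m                                                    ∎

mainTheorem1 : (a : ℕ) → 1 ≤ a → (n m : ℕ) → n ≤ m →
    (dec : Decidable (λ w → IsBallot w × EndsAt n m w × Avoids (replicate a r) w)) →
    (m + 1) * length (filter dec (words (n + m))) ≡ (m ∸ n + 1) * geomBinom (m + 1) n a
mainTheorem1 (suc a) (s≤s z≤n) n m n≤m dec = begin
  (m + 1) * length (filter dec (words (n + m)))  ≡⟨ cong₂ _*_ (+-comm m 1) (filter-count n m dec) ⟩
  suc m * pathCount n m                          ≡⟨ ballot-formula m n ⟩
  (suc m ∸ n) * geomBinom (suc m) n (suc a)      ≡⟨ cong₂ _*_ (trans (cong (_∸ n) (+-comm 1 m)) (+-∸-comm 1 n≤m))
                                                              (cong (λ x → geomBinom x n (suc a)) (+-comm 1 m)) ⟩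
  (m ∸ n + 1) * geomBinom (m + 1) n (suc a)      ∎
  where
  open Automaton a
  open BallotRecurrence a pathCount refl pathCount-below-diagonal pathCount-step
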